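{- Let $w\in\mathfrak{S}_n$ be right-almost-reducible at $i$. Then: (1) $\max\{w(1),\dots,w(i-1)\}=i+1$; (2) $w(i)>i+1$; (3) the (two) elements of $\{1,\dots,i+1\}\setminus\{w(1),\dots,w(i-1)\}$ appear out of order in the one-line notation of $w$, i.e. the larger of them appears to the left of the smaller.
   Context: $\mathfrak{S}_n$ is the Coxeter group with simple generators $S=\{s_1,\dots,s_{n-1}\}$, $s_i=(i\ i+1)$, permutations composed as functions $(uv)(k)=u(v(k))$, length $\ell$ = number of inversions. $\supp(x)$ is the set of simple generators in any reduced word of $x$; $D_L(x)=\{s\in S:\ell(sx)<\ell(x)\}$, $D_R(x)=\{s\in S:\ell(xs)<\ell(x)\}$. For $J\subseteq S$, $W_J=\langle J\rangle$ and each $x$ factors uniquely as $x=x^Jx_J$, $x_J\in W_J$, $x^J$ the minimal-length element of $xW_J$. $w=w^Jw_J$ is a Billey–Postnikov decomposition if $\supp(w^J)\cap J\subseteq D_L(w_J)$. $w$ is Bruhat irreducible if $\supp(w)=S$ and there is no factorization $w=w'w''$ with $w',w''\neq e$ and $\supp(w')\cap\supp(w'')=\emptyset$. A Bruhat irreducible $w$ is almost reducible at $(J,i)$ if $w=w^Jw_J$ is a BP decomposition with $\supp(w^J)\cap J=\{s_i\}$ and $s_i\notin D_L(w)\cup D_R(w)$. It is right-almost-reducible at $i$ if it is almost reducible at $(\{s_i,\dots,s_{n-1}\},i)$. -}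

module Defs where

open import Data.Nat as ℕ using (ℕ; zero; suc; _+_)
open import Data.Fin as Fin using (Fin; toℕ; inject₁)
open import Data.Fin.Properties using () renaming (_<?_ to _<ᶠ?_)
open import Data.Fin.Permutation using (Permutation′; _⟨$⟩ʳ_; _∘ₚ_; transpose; _≈_)
  renaming (id to idₚ)
open import Data.List using (List; []; _∷_; length; filter; map; allFin)
open import Data.Nat.ListAction using (sum)
open import Data.List.Membership.Propositional using (_∈_)
open import Data.List.Relation.Unary.All using (All)
open import Data.Product using (Σ; ∃; ∃-syntax; _×_; _,_)
open import Data.Empty using (⊥)
open import Relation.Nullary using (¬_)
open import Relation.Nullary.Decidable using (_×-dec_)
open import Relation.Binary.PropositionalEquality using (_≡_)

-- Elements of 𝔖ₙ with n = suc m, acting on Fin (suc m) (0-based positions/values).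
Perm : ℕ → Set
Perm m = Permutation′ (suc m)

-- Paper's product: (u · v)(k) = u (v k).  (stdlib's _∘ₚ_ is diagrammatic.)
_·_ : ∀ {m} → Perm m → Perm m → Perm m
u · v = v ∘ₚ u

-- Simple generators S = {s₁,…,s_m}: the generator g : Fin m is s_{toℕ g + 1},
-- swapping 0-based positions inject₁ g and suc g (1-based: toℕ g + 1, toℕ g + 2).
Gen : ℕ → Set
Gen m = Fin m

s : ∀ {m} → Gen m → Perm m
s g = transpose (inject₁ g) (Fin.suc g)

prod : ∀ {m} → List (Gen m) → Perm m
prod []      = idₚ
prod (g ∷ w) = s g · prod w

ℓ : ∀ {m} → Perm m → ℕ
ℓ {m} x = sum (map (λ a → length (filter (λ b → (a <ᶠ? b) ×-dec ((x ⟨$⟩ʳ b) <ᶠ? (x ⟨$⟩ʳ a)))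
                                          (allFin (suc m))))
                   (allFin (suc m)))

Reduced : ∀ {m} → List (Gen m) → Perm m → Set
Reduced w x = (prod w ≈ x) × (length w ≡ ℓ x)

-- supp(x): generators occurring in a reduced word of x (all reduced words have
-- the same support).
supp : ∀ {m} → Perm m → Gen m → Set
supp x g = ∃[ w ] (Reduced w x × g ∈ w)

D_L : ∀ {m} → Perm m → Gen m → Set
D_L x g = ℓ (s g · x) ℕ.< ℓ x

D_R : ∀ {m} → Perm m → Gen m → Set
D_R x g = ℓ (x · s g) ℕ.< ℓ x

InW : ∀ {m} → (Gen m → Set) → Perm m → Set
InW J x = ∃[ w ] (All J w × prod w ≈ x)

-- x = u · v is the parabolic factorization x = x^J x_J:
-- v = x_J ∈ W_J and u = x^J is of minimal length in u W_J = x W_J.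
ParabolicDecomp : ∀ {m} → (Gen m → Set) → Perm m → Perm m → Perm m → Set
ParabolicDecomp J x u v =
  (x ≈ (u · v)) × InW J v × (∀ y → InW J y → ℓ u ℕ.≤ ℓ (u · y))

BPCond : ∀ {m} → (Gen m → Set) → Perm m → Perm m → Set
BPCond J u v = ∀ g → supp u g → J g → D_L v g

BruhatIrreducible : ∀ {m} → Perm m → Set
BruhatIrreducible w =
  (∀ g → supp w g) ×
  ¬ (∃[ w′ ] ∃[ w″ ] ((w ≈ (w′ · w″)) × ¬ (w′ ≈ idₚ) × ¬ (w″ ≈ idₚ) ×
                      (∀ g → supp w′ g → supp w″ g → ⊥)))

AlmostReducible : ∀ {m} → Perm m → (Gen m → Set) → Gen m → Set
AlmostReducible w J g =
  BruhatIrreducible w ×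
  (∃[ u ] ∃[ v ] (ParabolicDecomp J w u v × BPCond J u v ×
                  (∀ h → (supp u h × J h → h ≡ g) × (h ≡ g → supp u h × J h)))) ×
  ¬ D_L w g × ¬ D_R w g

RightJ : ∀ {m} → Gen m → Gen m → Set
RightJ g h = toℕ g ℕ.≤ toℕ h

RightAlmostReducible : ∀ {m} → Perm m → Gen m → Set
RightAlmostReducible w g = AlmostReducible w (RightJ g) g

-- 1-based one-line notation: w(k) for the 0-based position p (k = toℕ p + 1).
val : ∀ {m} → Perm m → Fin (suc m) → ℕ
val w p = suc (toℕ (w ⟨$⟩ʳ p))

pos : ∀ {m} → Fin (suc m) → ℕ
pos p = suc (toℕ p)

-- Write w = u · v with v = w_J and u = w^J. Every letter of a word for v lies in
-- J, so v fixes the positions before i; supp u ∩ J = {s_i} makes u fix the positions after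
-- i + 1, so u permutes {1,…,i+1}. Minimality of u gives u(i) < u(i+1), and s_i ∈ supp u
-- forces u(i+1) ≤ i, so the value i + 1 of u (and of w) sits before position i: this is (1).
-- At a position p ≥ i, w(p) ≤ i + 1 forces v(p) ∈ {i, i+1}, and the BP condition (s_i is a
-- left descent of v) puts v⁻¹(i+1) before v⁻¹(i): this is (3). Finally v(i) = i contradicts
-- that descent, while v(i) = i + 1 would split w = (u s_i)(s_i v) into factors supported on
-- {s_1,…,s_i} and {s_{i+1},…}, both nontrivial because s_i is neither a left nor a right
-- descent of w. Hence v(i) > i + 1 and w(i) = v(i): this is (2).

module Submission where

open import Defs
open import Data.Nat using (ℕ; suc; _≤_; _<_)
open import Data.Fin using (Fin; toℕ; inject₁)
open import Data.Product using (∃-syntax; _×_)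
open import Relation.Binary.PropositionalEquality using (_≡_)

open import Data.Nat as ℕ using (zero; _+_; _∸_; s≤s)
open import Data.Nat.Properties
open import Data.Fin as Fin using ()
open import Data.Fin.Properties using (toℕ-injective; toℕ-inject₁; toℕ<n; toℕ-fromℕ; toℕ-fromℕ<; any?)
  renaming (_<?_ to _<ᶠ?_; suc-injective to Fin-suc-injective)
open import Data.Fin.Permutation using (_⟨$⟩ʳ_; _⟨$⟩ˡ_; flip; inverseˡ; inverseʳ; _≈_)
  renaming (id to idₚ)
open import Data.List using (List; []; _∷_; length; filter; map; tabulate; allFin)
import Data.Nat.ListAction as List
open import Data.List.Membership.Propositional using (_∈_; _∉_)
open import Data.List.Relation.Unary.All using (All; []; _∷_)
open import Data.List.Relation.Unary.Any as Any using (here; there)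
open import Algebra.Properties.CommutativeMonoid.Sum +-0-commutativeMonoid
  using (sum; sum-syntax; ∑-comm; sum-permute; sum-cong-≗; sum-replicate-zero)
open import Data.Product using (_,_; proj₁; proj₂)
open import Data.Sum using (_⊎_; inj₁; inj₂; [_,_])
open import Data.Empty using (⊥)
open import Function using (_∘_; id)
open import Relation.Nullary using (Dec; yes; no; ¬_; contradiction)
open import Relation.Nullary.Decidable using (_×-dec_)
open import Relation.Unary using (Pred; Decidable)
open import Relation.Binary using (tri<; tri≈; tri>)
open import Relation.Binary.PropositionalEquality hiding ([_])

adjSwap : ℕ → ℕ → ℕ
adjSwap K c with c ℕ.≟ K
... | yes _ = suc K
... | no _ with c ℕ.≟ suc K
...   | yes _ = K
...   | no _ = c

adjSwap-left : ∀ K → adjSwap K K ≡ suc K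
adjSwap-left K with K ℕ.≟ K
... | yes _ = refl
... | no K≢K = contradiction refl K≢K

adjSwap-right : ∀ K → adjSwap K (suc K) ≡ K
adjSwap-right K with suc K ℕ.≟ K
... | yes 1+K≡K = contradiction 1+K≡K 1+n≢n
... | no _ with suc K ℕ.≟ suc K
...   | yes _ = refl
...   | no 1+K≢1+K = contradiction refl 1+K≢1+K

adjSwap-other : ∀ {K c} → c ≢ K → c ≢ suc K → adjSwap K c ≡ c
adjSwap-other {K} {c} c≢K c≢1+K with c ℕ.≟ K
... | yes c≡K = contradiction c≡K c≢K
... | no _ with c ℕ.≟ suc K
...   | yes c≡1+K = contradiction c≡1+K c≢1+K
...   | no _ = refl

adjSwap-involutive : ∀ K c → adjSwap K (adjSwap K c) ≡ c
adjSwap-involutive K c with c ℕ.≟ K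
... | yes refl = adjSwap-right K
... | no c≢K with c ℕ.≟ suc K
...   | yes refl = adjSwap-left K
...   | no c≢1+K = adjSwap-other c≢K c≢1+K

data AdjSwapView (K c : ℕ) : Set where
  at-left  : c ≡ K → adjSwap K c ≡ suc K → AdjSwapView K c
  at-right : c ≡ suc K → adjSwap K c ≡ K → AdjSwapView K c
  away     : c ≢ K → c ≢ suc K → adjSwap K c ≡ c → AdjSwapView K c

adjSwap-view : ∀ K c → AdjSwapView K c
adjSwap-view K c with c ℕ.≟ K
... | yes refl = at-left refl (adjSwap-left K)
... | no c≢K with c ℕ.≟ suc K
...   | yes refl = at-right refl (adjSwap-right K)
...   | no c≢1+K = away c≢K c≢1+K (adjSwap-other c≢K c≢1+K)

adjSwap-mono-< : ∀ {K c d} → ¬ (c ≡ K × d ≡ suc K) → c < d → adjSwap K c < adjSwap K d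
adjSwap-mono-< {K} {c} {d} not-pair c<d with adjSwap-view K c | adjSwap-view K d
... | at-left refl _ | at-left refl _ = contradiction c<d (<-irrefl refl)
... | at-left refl _ | at-right d≡1+K _ = contradiction (refl , d≡1+K) not-pair
... | at-left refl p | away _ d≢1+K q rewrite p | q = ≤∧≢⇒< c<d (d≢1+K ∘ sym)
... | at-right refl _ | at-left refl _ = contradiction (n<1+n K) (<-asym c<d)
... | at-right refl _ | at-right refl _ = contradiction c<d (<-irrefl refl)
... | at-right refl p | away _ _ q rewrite p | q = <-trans (n<1+n K) c<d
... | away _ _ p | at-left refl q rewrite p | q = m<n⇒m<1+n c<d
... | away c≢K _ p | at-right refl q rewrite p | q = ≤∧≢⇒< (m<1+n⇒m≤n c<d) c≢K
... | away _ _ p | away _ _ q rewrite p | q = c<d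

adjSwap-cancel-< : ∀ {K c d} → ¬ (c ≡ suc K × d ≡ K) → adjSwap K c < adjSwap K d → c < d
adjSwap-cancel-< {K} {c} {d} not-pair sc<sd =
  subst₂ _<_ (adjSwap-involutive K c) (adjSwap-involutive K d) (adjSwap-mono-< not-swapped sc<sd)
  where
  not-swapped : ¬ (adjSwap K c ≡ K × adjSwap K d ≡ suc K)
  not-swapped (sc≡K , sd≡1+K) =
    not-pair ( trans (sym (adjSwap-involutive K c)) (trans (cong (adjSwap K) sc≡K) (adjSwap-left K))
             , trans (sym (adjSwap-involutive K d)) (trans (cong (adjSwap K) sd≡1+K) (adjSwap-right K)))

adjSwap-≤ : ∀ {K H c} → K ≢ H → c ≤ H → adjSwap K c ≤ H
adjSwap-≤ {K} {H} {c} K≢H c≤H with adjSwap-view K c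
... | at-left refl p = subst (_≤ H) (sym p) (≤∧≢⇒< c≤H K≢H)
... | at-right refl p = subst (_≤ H) (sym p) (≤-trans (n≤1+n K) c≤H)
... | away _ _ p = subst (_≤ H) (sym p) c≤H

adjSwap-> : ∀ {K H c} → ¬ (c ≡ suc K × K ≡ H) → H < c → H < adjSwap K c
adjSwap-> {K} {H} {c} not-pair H<c with adjSwap-view K c
... | at-left refl p = subst (H <_) (sym p) (m<n⇒m<1+n H<c)
... | at-right refl p =
  subst (H <_) (sym p) (≤∧≢⇒< (m<1+n⇒m≤n H<c) (λ H≡K → not-pair (refl , sym H≡K)))
... | away _ _ p = subst (H <_) (sym p) H<c

toℕ-s : ∀ {m} (k : Gen m) c → toℕ (s k ⟨$⟩ʳ c) ≡ adjSwap (toℕ k) (toℕ c)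
toℕ-s k c with c Fin.≟ inject₁ k
... | yes refl = sym (trans (cong (adjSwap (toℕ k)) (toℕ-inject₁ k)) (adjSwap-left (toℕ k)))
... | no c≢k with c Fin.≟ Fin.suc k
...   | yes refl = trans (toℕ-inject₁ k) (sym (adjSwap-right (toℕ k)))
...   | no c≢1+k = sym (adjSwap-other (λ e → c≢k (toℕ-injective (trans e (sym (toℕ-inject₁ k)))))
                                      (c≢1+k ∘ toℕ-injective))

s-involutive : ∀ {m} (k : Gen m) c → s k ⟨$⟩ʳ (s k ⟨$⟩ʳ c) ≡ c
s-involutive k c = toℕ-injective (begin
  toℕ (s k ⟨$⟩ʳ (s k ⟨$⟩ʳ c))            ≡⟨ toℕ-s k (s k ⟨$⟩ʳ c) ⟩
  adjSwap (toℕ k) (toℕ (s k ⟨$⟩ʳ c))      ≡⟨ cong (adjSwap (toℕ k)) (toℕ-s k c) ⟩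
  adjSwap (toℕ k) (adjSwap (toℕ k) (toℕ c)) ≡⟨ adjSwap-involutive (toℕ k) (toℕ c) ⟩
  toℕ c                                    ∎)
  where open ≡-Reasoning

s-inject₁ : ∀ {m} (k : Gen m) → s k ⟨$⟩ʳ inject₁ k ≡ Fin.suc k
s-inject₁ k = toℕ-injective (trans (toℕ-s k (inject₁ k))
                              (trans (cong (adjSwap (toℕ k)) (toℕ-inject₁ k)) (adjSwap-left (toℕ k))))

s-suc : ∀ {m} (k : Gen m) → s k ⟨$⟩ʳ Fin.suc k ≡ inject₁ k
s-suc k = toℕ-injective (trans (toℕ-s k (Fin.suc k)) (trans (adjSwap-right (toℕ k)) (sym (toℕ-inject₁ k))))

s-fixes : ∀ {m} (k : Gen m) {c} → toℕ c ≢ toℕ k → toℕ c ≢ suc (toℕ k) → s k ⟨$⟩ʳ c ≡ c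
s-fixes k {c} c≢k c≢1+k = toℕ-injective (trans (toℕ-s k c) (adjSwap-other c≢k c≢1+k))

flip-s : ∀ {m} (k : Gen m) c → s k ⟨$⟩ˡ c ≡ s k ⟨$⟩ʳ c
flip-s k c = trans (sym (s-involutive k (s k ⟨$⟩ˡ c))) (cong (s k ⟨$⟩ʳ_) (inverseʳ (s k) {c}))

⟨$⟩ʳ⇒⟨$⟩ˡ : ∀ {m} (x : Perm m) {p c} → x ⟨$⟩ʳ p ≡ c → x ⟨$⟩ˡ c ≡ p
⟨$⟩ʳ⇒⟨$⟩ˡ x xp≡c = trans (cong (x ⟨$⟩ˡ_) (sym xp≡c)) (inverseˡ x)

⟨$⟩ʳ-injective : ∀ {m} (x : Perm m) {a b} → x ⟨$⟩ʳ a ≡ x ⟨$⟩ʳ b → a ≡ b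
⟨$⟩ʳ-injective x xa≡xb = trans (sym (inverseˡ x)) (⟨$⟩ʳ⇒⟨$⟩ˡ x (sym xa≡xb))

toℕ-⟨$⟩ʳ-injective : ∀ {m} (x : Perm m) {a b} → toℕ (x ⟨$⟩ʳ a) ≡ toℕ (x ⟨$⟩ʳ b) → a ≡ b
toℕ-⟨$⟩ʳ-injective x = ⟨$⟩ʳ-injective x ∘ toℕ-injective

inject₁≢suc : ∀ {m} (k : Fin m) → inject₁ k ≢ Fin.suc k
inject₁≢suc k e = 1+n≢n (sym (trans (sym (toℕ-inject₁ k)) (cong toℕ e)))

𝟙 : ∀ {A : Set} → Dec A → ℕ
𝟙 (yes _) = 1
𝟙 (no _) = 0

𝟙-yes : ∀ {A : Set} (a? : Dec A) → A → 𝟙 a? ≡ 1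
𝟙-yes (yes _) _ = refl
𝟙-yes (no ¬a) a = contradiction a ¬a

𝟙-no : ∀ {A : Set} (a? : Dec A) → ¬ A → 𝟙 a? ≡ 0
𝟙-no (yes a) ¬a = contradiction a ¬a
𝟙-no (no _) _ = refl

𝟙-cong : ∀ {A B : Set} (a? : Dec A) (b? : Dec B) → (A → B) → (B → A) → 𝟙 a? ≡ 𝟙 b?
𝟙-cong (yes _) (yes _) _ _ = refl
𝟙-cong (yes a) (no ¬b) f _ = contradiction (f a) ¬b
𝟙-cong (no ¬a) (yes b) _ g = contradiction (g b) ¬a
𝟙-cong (no _) (no _) _ _ = refl

sum-map-tabulate : ∀ {A : Set} {n} (h : Fin n → A) (f : A → ℕ) →
  List.sum (map f (tabulate h)) ≡ sum (f ∘ h)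
sum-map-tabulate {n = zero} h f = refl
sum-map-tabulate {n = suc n} h f = cong (f (h Fin.zero) +_) (sum-map-tabulate (h ∘ Fin.suc) f)

length-filter-tabulate : ∀ {A : Set} {P : Pred A _} (P? : Decidable P) {n} (h : Fin n → A) →
  length (filter P? (tabulate h)) ≡ sum (λ b → 𝟙 (P? (h b)))
length-filter-tabulate P? {zero} h = refl
length-filter-tabulate P? {suc n} h with P? (h Fin.zero)
... | yes _ = cong suc (length-filter-tabulate P? (h ∘ Fin.suc))
... | no _ = length-filter-tabulate P? (h ∘ Fin.suc)

sum-zero : ∀ {n} {f : Fin n → ℕ} → (∀ a → f a ≡ 0) → sum f ≡ 0
sum-zero {n} f≡0 = trans (sum-cong-≗ f≡0) (sum-replicate-zero n)

sum-increment : ∀ {n} (f f′ : Fin n → ℕ) (a₀ : Fin n) → f′ a₀ ≡ suc (f a₀) →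
  (∀ a → a ≢ a₀ → f′ a ≡ f a) → sum f′ ≡ suc (sum f)
sum-increment f f′ Fin.zero at elsewhere =
  cong₂ _+_ at (sum-cong-≗ (λ a → elsewhere (Fin.suc a) (λ ())))
sum-increment f f′ (Fin.suc a₀) at elsewhere =
  trans (cong₂ _+_ (elsewhere Fin.zero (λ ()))
                   (sum-increment (f ∘ Fin.suc) (f′ ∘ Fin.suc) a₀ at
                                  (λ a a≢a₀ → elsewhere (Fin.suc a) (a≢a₀ ∘ Fin-suc-injective))))
        (+-suc _ _)

∑∑-increment : ∀ {n} (F F′ : Fin n → Fin n → ℕ) (a₀ b₀ : Fin n) →
  F′ a₀ b₀ ≡ suc (F a₀ b₀) →
  (∀ a b → ¬ (a ≡ a₀ × b ≡ b₀) → F′ a b ≡ F a b) →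
  ∑[ a < n ] ∑[ b < n ] F′ a b ≡ suc (∑[ a < n ] ∑[ b < n ] F a b)
∑∑-increment F F′ a₀ b₀ at elsewhere =
  sum-increment (λ a → sum (F a)) (λ a → sum (F′ a)) a₀
    (sum-increment (F a₀) (F′ a₀) b₀ at (λ b b≢b₀ → elsewhere a₀ b (b≢b₀ ∘ proj₂)))
    (λ a a≢a₀ → sum-cong-≗ (λ b → elsewhere a b (a≢a₀ ∘ proj₁)))

Inversion : ∀ {m} → Perm m → Fin (suc m) → Fin (suc m) → Set
Inversion x a b = a Fin.< b × x ⟨$⟩ʳ b Fin.< x ⟨$⟩ʳ a

inversion? : ∀ {m} (x : Perm m) a b → Dec (Inversion x a b)
inversion? x a b = (a <ᶠ? b) ×-dec ((x ⟨$⟩ʳ b) <ᶠ? (x ⟨$⟩ʳ a))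

inversion : ∀ {m} → Perm m → Fin (suc m) → Fin (suc m) → ℕ
inversion x a b = 𝟙 (inversion? x a b)

ℓ≡∑∑inversion : ∀ {m} (x : Perm m) → ℓ x ≡ ∑[ a < suc m ] ∑[ b < suc m ] inversion x a b
ℓ≡∑∑inversion {m} x =
  trans (sum-map-tabulate id (λ a → length (filter (inversion? x a) (allFin (suc m)))))
        (sum-cong-≗ (λ a → length-filter-tabulate (inversion? x a) id))

ℓ-cong : ∀ {m} {x y : Perm m} → x ≈ y → ℓ x ≡ ℓ y
ℓ-cong {m} {x} {y} x≈y = begin
  ℓ x                                           ≡⟨ ℓ≡∑∑inversion x ⟩
  ∑[ a < suc m ] ∑[ b < suc m ] inversion x a b ≡⟨ sum-cong-≗ (λ a → sum-cong-≗ (λ b → same-inversion a b)) ⟩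
  ∑[ a < suc m ] ∑[ b < suc m ] inversion y a b ≡⟨ ℓ≡∑∑inversion y ⟨
  ℓ y                                           ∎
  where
  open ≡-Reasoning
  same-inversion : ∀ a b → inversion x a b ≡ inversion y a b
  same-inversion a b = cong₂ (λ c d → 𝟙 ((a <ᶠ? b) ×-dec (c <ᶠ? d))) (x≈y b) (x≈y a)

ℓ-id : ∀ {m} → ℓ (idₚ {suc m}) ≡ 0
ℓ-id {m} = trans (ℓ≡∑∑inversion (idₚ {suc m}))
  (sum-zero λ a → sum-zero λ b → 𝟙-no (inversion? (idₚ {suc m}) a b) λ (a<b , b<a) → <-asym a<b b<a)

ℓ-flip : ∀ {m} (x : Perm m) → ℓ (flip x) ≡ ℓ x
ℓ-flip {m} x = sym (begin
  ℓ x
    ≡⟨ ℓ≡∑∑inversion x ⟩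
  ∑[ a < suc m ] ∑[ b < suc m ] inversion x a b
    ≡⟨ sum-permute (λ a → ∑[ b < suc m ] inversion x a b) (flip x) ⟩
  ∑[ c < suc m ] ∑[ b < suc m ] inversion x (x ⟨$⟩ˡ c) b
    ≡⟨ sum-cong-≗ (λ c → sum-permute (inversion x (x ⟨$⟩ˡ c)) (flip x)) ⟩
  ∑[ c < suc m ] ∑[ d < suc m ] inversion x (x ⟨$⟩ˡ c) (x ⟨$⟩ˡ d)
    ≡⟨ ∑-comm (λ c d → inversion x (x ⟨$⟩ˡ c) (x ⟨$⟩ˡ d)) ⟩
  ∑[ d < suc m ] ∑[ c < suc m ] inversion x (x ⟨$⟩ˡ c) (x ⟨$⟩ˡ d)
    ≡⟨ sum-cong-≗ (λ d → sum-cong-≗ (λ c → inversion-flip c d)) ⟩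
  ∑[ d < suc m ] ∑[ c < suc m ] inversion (flip x) d c
    ≡⟨ ℓ≡∑∑inversion (flip x) ⟨
  ℓ (flip x)
    ∎)
  where
  open ≡-Reasoning
  inversion-flip : ∀ c d → inversion x (x ⟨$⟩ˡ c) (x ⟨$⟩ˡ d) ≡ inversion (flip x) d c
  inversion-flip c d =
    𝟙-cong (inversion? x (x ⟨$⟩ˡ c) (x ⟨$⟩ˡ d)) (inversion? (flip x) d c)
      (λ (p , q) → subst₂ Fin._<_ (inverseʳ x) (inverseʳ x) q , p)
      (λ (q , p) → p , subst₂ Fin._<_ (sym (inverseʳ x)) (sym (inverseʳ x)) q)

Ascent : ∀ {m} → Perm m → Gen m → Set
Ascent x k = toℕ (x ⟨$⟩ʳ inject₁ k) < toℕ (x ⟨$⟩ʳ Fin.suc k)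

Descent : ∀ {m} → Perm m → Gen m → Set
Descent x k = toℕ (x ⟨$⟩ʳ Fin.suc k) < toℕ (x ⟨$⟩ʳ inject₁ k)

ascent⊎descent : ∀ {m} (x : Perm m) k → Ascent x k ⊎ Descent x k
ascent⊎descent x k with <-cmp (toℕ (x ⟨$⟩ʳ inject₁ k)) (toℕ (x ⟨$⟩ʳ Fin.suc k))
... | tri< asc _ _ = inj₁ asc
... | tri≈ _ e _ = contradiction (toℕ-⟨$⟩ʳ-injective x e) (inject₁≢suc k)
... | tri> _ _ desc = inj₂ desc

-- Ascent (flip y) k: the value k stands left of the value k + 1 in y. Left multiplication
-- by s k exchanges these two values, so only the pair of positions holding them changes status.
ℓ-s·-ascent : ∀ {m} (y : Perm m) (k : Gen m) → Ascent (flip y) k → ℓ (s k · y) ≡ suc (ℓ y)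
ℓ-s·-ascent {m} y k a₀<b₀ = begin
  ℓ (s k · y)
    ≡⟨ ℓ≡∑∑inversion (s k · y) ⟩
  ∑[ a < suc m ] ∑[ b < suc m ] inversion (s k · y) a b
    ≡⟨ ∑∑-increment (inversion y) (inversion (s k · y)) a₀ b₀ at-pair elsewhere ⟩
  suc (∑[ a < suc m ] ∑[ b < suc m ] inversion y a b)
    ≡⟨ cong suc (ℓ≡∑∑inversion y) ⟨
  suc (ℓ y)
    ∎
  where
  open ≡-Reasoning
  K : ℕ
  K = toℕ k
  a₀ b₀ : Fin (suc m)
  a₀ = y ⟨$⟩ˡ inject₁ k
  b₀ = y ⟨$⟩ˡ Fin.suc k
  y-a₀ : toℕ (y ⟨$⟩ʳ a₀) ≡ K
  y-a₀ = trans (cong toℕ (inverseʳ y)) (toℕ-inject₁ k)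
  y-b₀ : toℕ (y ⟨$⟩ʳ b₀) ≡ suc K
  y-b₀ = cong toℕ (inverseʳ y)
  sy : ∀ a → toℕ ((s k · y) ⟨$⟩ʳ a) ≡ adjSwap K (toℕ (y ⟨$⟩ʳ a))
  sy a = toℕ-s k (y ⟨$⟩ʳ a)
  at-pair : inversion (s k · y) a₀ b₀ ≡ suc (inversion y a₀ b₀)
  at-pair = trans
    (𝟙-yes (inversion? (s k · y) a₀ b₀)
      (a₀<b₀ , subst₂ _<_ (sym (trans (sy b₀) (trans (cong (adjSwap K) y-b₀) (adjSwap-right K))))
                          (sym (trans (sy a₀) (trans (cong (adjSwap K) y-a₀) (adjSwap-left K))))
                          (n<1+n K)))
    (cong suc (sym (𝟙-no (inversion? y a₀ b₀)
      λ (_ , b<a) → <-asym (n<1+n K) (subst₂ _<_ y-b₀ y-a₀ b<a))))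
  elsewhere : ∀ a b → ¬ (a ≡ a₀ × b ≡ b₀) → inversion (s k · y) a b ≡ inversion y a b
  elsewhere a b not-pair = 𝟙-cong (inversion? (s k · y) a b) (inversion? y a b)
    (λ (a<b , sb<sa) → a<b , adjSwap-cancel-<
        (λ (b-K+1 , a-K) → not-pair ( toℕ-⟨$⟩ʳ-injective y (trans a-K (sym y-a₀))
                                    , toℕ-⟨$⟩ʳ-injective y (trans b-K+1 (sym y-b₀))))
        (subst₂ _<_ (sy b) (sy a) sb<sa))
    (λ (a<b , yb<ya) → a<b , subst₂ _<_ (sym (sy b)) (sym (sy a)) (adjSwap-mono-<
        (λ (b-K , a-K+1) → <-asym a₀<b₀
          (subst₂ _<_ (cong toℕ (toℕ-⟨$⟩ʳ-injective y (trans a-K+1 (sym y-b₀))))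
                      (cong toℕ (toℕ-⟨$⟩ʳ-injective y (trans b-K (sym y-a₀)))) a<b))
        yb<ya))

ℓ-s·-descent : ∀ {m} (y : Perm m) (k : Gen m) → Descent (flip y) k → suc (ℓ (s k · y)) ≡ ℓ y
ℓ-s·-descent y k b₀<a₀ = begin
  suc (ℓ (s k · y))     ≡⟨ ℓ-s·-ascent (s k · y) k ascent ⟨
  ℓ (s k · (s k · y))   ≡⟨ ℓ-cong {x = s k · (s k · y)} {y} (λ a → s-involutive k (y ⟨$⟩ʳ a)) ⟩
  ℓ y                   ∎
  where
  open ≡-Reasoning
  ascent : Ascent (flip (s k · y)) k
  ascent = subst₂ (λ c d → toℕ (y ⟨$⟩ˡ c) < toℕ (y ⟨$⟩ˡ d))
             (sym (trans (flip-s k (inject₁ k)) (s-inject₁ k)))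
             (sym (trans (flip-s k (Fin.suc k)) (s-suc k))) b₀<a₀

ℓ-·s-descent : ∀ {m} (x : Perm m) (k : Gen m) → Descent x k → suc (ℓ (x · s k)) ≡ ℓ x
ℓ-·s-descent x k desc = begin
  suc (ℓ (x · s k))         ≡⟨ cong suc (ℓ-flip (x · s k)) ⟨
  suc (ℓ (flip (x · s k)))  ≡⟨ cong suc (ℓ-cong {x = flip (x · s k)} {s k · flip x} (flip-s k ∘ (x ⟨$⟩ˡ_))) ⟩
  suc (ℓ (s k · flip x))    ≡⟨ ℓ-s·-descent (flip x) k desc ⟩
  ℓ (flip x)                ≡⟨ ℓ-flip x ⟩
  ℓ x                       ∎
  where open ≡-Reasoning

leftDescent⇒Descent : ∀ {m} (y : Perm m) k → D_L y k → Descent (flip y) k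
leftDescent⇒Descent y k ℓsy<ℓy with ascent⊎descent (flip y) k
... | inj₁ asc = contradiction (subst (_< ℓ y) (ℓ-s·-ascent y k asc) ℓsy<ℓy) (<-asym (n<1+n (ℓ y)))
... | inj₂ desc = desc

¬leftDescent⇒Ascent : ∀ {m} (y : Perm m) k → ¬ D_L y k → Ascent (flip y) k
¬leftDescent⇒Ascent y k ¬ℓsy<ℓy with ascent⊎descent (flip y) k
... | inj₁ asc = asc
... | inj₂ desc = contradiction (≤-reflexive (ℓ-s·-descent y k desc)) ¬ℓsy<ℓy

¬rightDescent⇒Ascent : ∀ {m} (x : Perm m) k → ¬ D_R x k → Ascent x k
¬rightDescent⇒Ascent x k ¬ℓxs<ℓx with ascent⊎descent x k
... | inj₁ asc = asc
... | inj₂ desc = contradiction (≤-reflexive (ℓ-·s-descent x k desc)) ¬ℓxs<ℓx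

ascending⊎descent : ∀ {m} (x : Perm m) → (∀ k → Ascent x k) ⊎ ∃[ k ] Descent x k
ascending⊎descent x with any? (λ k → toℕ (x ⟨$⟩ʳ Fin.suc k) ℕ.<? toℕ (x ⟨$⟩ʳ inject₁ k))
... | yes descent = inj₂ descent
... | no no-descent = inj₁ ascent
  where
  ascent : ∀ k → Ascent x k
  ascent k with ascent⊎descent x k
  ... | inj₁ asc = asc
  ... | inj₂ desc = contradiction (k , desc) no-descent

ℓ-s·-≤ : ∀ {m} (y : Perm m) (k : Gen m) → ℓ (s k · y) ≤ suc (ℓ y)
ℓ-s·-≤ y k with ascent⊎descent (flip y) k
... | inj₁ asc = ≤-reflexive (ℓ-s·-ascent y k asc)
... | inj₂ desc = ≤-trans (n≤1+n _) (≤-trans (≤-reflexive (ℓ-s·-descent y k desc)) (n≤1+n _))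

ℓ-prod≤length : ∀ {m} (r : List (Gen m)) → ℓ (prod r) ≤ length r
ℓ-prod≤length {m} [] = ≤-reflexive (ℓ-id {m})
ℓ-prod≤length (k ∷ r) = ≤-trans (ℓ-s·-≤ (prod r) k) (s≤s (ℓ-prod≤length r))

ascending-spread : ∀ {m} (x : Perm m) → (∀ k → Ascent x k) →
  ∀ j {c d} → toℕ d ≡ toℕ c + j → toℕ (x ⟨$⟩ʳ c) + j ≤ toℕ (x ⟨$⟩ʳ d)
ascending-spread x asc zero {c} {d} d≡c+0
  rewrite toℕ-injective {i = d} {c} (trans d≡c+0 (+-identityʳ _)) = ≤-reflexive (+-identityʳ _)
ascending-spread x asc (suc j) {c} {Fin.zero} 0≡c+1+j =
  contradiction (trans (sym (+-suc _ _)) (sym 0≡c+1+j)) 1+n≢0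
ascending-spread x asc (suc j) {c} {Fin.suc d} 1+d≡c+1+j = begin
  toℕ (x ⟨$⟩ʳ c) + suc j         ≡⟨ +-suc _ _ ⟩
  suc (toℕ (x ⟨$⟩ʳ c) + j)       ≤⟨ s≤s (ascending-spread x asc j d≡c+j) ⟩
  suc (toℕ (x ⟨$⟩ʳ inject₁ d))   ≤⟨ asc d ⟩
  toℕ (x ⟨$⟩ʳ Fin.suc d)         ∎
  where
  open ≤-Reasoning
  d≡c+j : toℕ (inject₁ d) ≡ toℕ c + j
  d≡c+j = trans (toℕ-inject₁ d) (suc-injective (trans 1+d≡c+1+j (+-suc _ _)))

ascending⇒≈id : ∀ {m} (x : Perm m) → (∀ k → Ascent x k) → x ≈ idₚ
ascending⇒≈id {m} x asc p = toℕ-injective (≤-antisym upper lower)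
  where
  p≤m : toℕ p ≤ m
  p≤m = ≤-pred (toℕ<n p)
  lower : toℕ p ≤ toℕ (x ⟨$⟩ʳ p)
  lower = ≤-trans (m≤n+m (toℕ p) _) (ascending-spread x asc (toℕ p) {Fin.zero} refl)
  upper : toℕ (x ⟨$⟩ʳ p) ≤ toℕ p
  upper = +-cancelʳ-≤ (m ∸ toℕ p) (toℕ (x ⟨$⟩ʳ p)) (toℕ p) (begin
    toℕ (x ⟨$⟩ʳ p) + (m ∸ toℕ p)  ≤⟨ ascending-spread x asc (m ∸ toℕ p) last≡p+[m∸p] ⟩
    toℕ (x ⟨$⟩ʳ Fin.fromℕ m)      ≤⟨ ≤-pred (toℕ<n _) ⟩
    m                              ≡⟨ m+[n∸m]≡n p≤m ⟨
    toℕ p + (m ∸ toℕ p)            ∎)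
    where
    open ≤-Reasoning
    last≡p+[m∸p] : toℕ (Fin.fromℕ m) ≡ toℕ p + (m ∸ toℕ p)
    last≡p+[m∸p] = trans (toℕ-fromℕ m) (sym (m+[n∸m]≡n p≤m))

reduced-[] : ∀ {m} (x : Perm m) → (∀ k → Ascent (flip x) k) → Reduced [] x
reduced-[] {m} x asc = id≈x , sym (trans (ℓ-cong {x = x} {idₚ} (λ p → sym (id≈x p))) (ℓ-id {m}))
  where
  id≈x : idₚ ≈ x
  id≈x p = trans (sym (inverseʳ x)) (cong (x ⟨$⟩ʳ_) (ascending⇒≈id (flip x) asc p))

reduced-∷ : ∀ {m} (x : Perm m) k {r} → Descent (flip x) k → Reduced r (s k · x) → Reduced (k ∷ r) x
reduced-∷ x k desc (r≈sx , |r|≡ℓsx) =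
  (λ p → trans (cong (s k ⟨$⟩ʳ_) (r≈sx p)) (s-involutive k (x ⟨$⟩ʳ p))) ,
  trans (cong suc |r|≡ℓsx) (ℓ-s·-descent x k desc)

reducedWord : ∀ {m} (x : Perm m) → ∃[ r ] Reduced r x
reducedWord x = go (ℓ x) x refl
  where
  go : ∀ {m} n (y : Perm m) → ℓ y ≡ n → ∃[ r ] Reduced r y
  go n y ℓy≡n with ascending⊎descent (flip y)
  go n       y ℓy≡n   | inj₁ asc = [] , reduced-[] y asc
  go zero    y ℓy≡0   | inj₂ (k , desc) = contradiction (trans (ℓ-s·-descent y k desc) ℓy≡0) 1+n≢0
  go (suc n) y ℓy≡1+n | inj₂ (k , desc)
    with go n (s k · y) (suc-injective (trans (ℓ-s·-descent y k desc) ℓy≡1+n))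
  ... | r , red = k ∷ r , reduced-∷ y k {r} desc red

Stabilises : ∀ {m} → ℕ → Perm m → Set
Stabilises H x = (∀ p → toℕ p ≤ H → toℕ (x ⟨$⟩ʳ p) ≤ H)
               × (∀ p → H < toℕ p → H < toℕ (x ⟨$⟩ʳ p))

stabilises-cong : ∀ {m H} {x y : Perm m} → x ≈ y → Stabilises H x → Stabilises H y
stabilises-cong {H = H} x≈y (below , above) =
  (λ p p≤H → subst (_≤ H) (cong toℕ (x≈y p)) (below p p≤H)) ,
  (λ p H<p → subst (H <_) (cong toℕ (x≈y p)) (above p H<p))

stabilises-· : ∀ {m H} {x y : Perm m} → Stabilises H x → Stabilises H y → Stabilises H (x · y)
stabilises-· (x-below , x-above) (y-below , y-above) =
  (λ p p≤H → x-below _ (y-below p p≤H)) , (λ p H<p → x-above _ (y-above p H<p))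

stabilises-s : ∀ {m H} (k : Gen m) → toℕ k ≢ H → Stabilises H (s k)
stabilises-s {H = H} k k≢H =
  (λ p p≤H → subst (_≤ H) (sym (toℕ-s k p)) (adjSwap-≤ k≢H p≤H)) ,
  (λ p H<p → subst (H <_) (sym (toℕ-s k p)) (adjSwap-> (k≢H ∘ proj₂) H<p))

stabilises-prod : ∀ {m} {h : Gen m} r → h ∉ r → Stabilises (toℕ h) (prod r)
stabilises-prod [] _ = (λ _ p≤H → p≤H) , (λ _ H<p → H<p)
stabilises-prod (k ∷ r) h∉kr =
  stabilises-· {x = s k} {prod r} (stabilises-s k (λ k≡h → h∉kr (here (sym (toℕ-injective k≡h)))))
               (stabilises-prod r (h∉kr ∘ there))

Crosses : ∀ {m} → ℕ → Perm m → Set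
Crosses H y = ∃[ p ] (toℕ p ≤ H × H < toℕ (y ⟨$⟩ʳ p))

crosses⇒¬stabilises : ∀ {m H} {y : Perm m} → Crosses H y → ¬ Stabilises H y
crosses⇒¬stabilises (p , p≤H , H<yp) (below , _) = <⇒≱ H<yp (below p p≤H)

crosses-s· : ∀ {m H} (y : Perm m) (k : Gen m) → Ascent (flip y) k → Crosses H y → Crosses H (s k · y)
crosses-s· {m} {H} y k asc (p , p≤H , H<yp)
  with (toℕ (y ⟨$⟩ʳ p) ℕ.≟ suc (toℕ k)) ×-dec (toℕ k ℕ.≟ H)
... | no not-pair = p , p≤H , subst (H <_) (sym (toℕ-s k (y ⟨$⟩ʳ p))) (adjSwap-> not-pair H<yp)
... | yes (yp≡1+k , refl) = a₀ , a₀≤k , subst (toℕ k <_) (sym (cong toℕ s-y-a₀)) (n<1+n (toℕ k))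
  -- s k moves the value k + 1 from p to the position a₀ < p of k.
  where
  a₀ : Fin (suc m)
  a₀ = y ⟨$⟩ˡ inject₁ k
  p≡b₀ : y ⟨$⟩ˡ Fin.suc k ≡ p
  p≡b₀ = ⟨$⟩ʳ⇒⟨$⟩ˡ y (toℕ-injective yp≡1+k)
  a₀≤k : toℕ a₀ ≤ toℕ k
  a₀≤k = <⇒≤ (<-≤-trans (subst (λ b → toℕ a₀ < toℕ b) p≡b₀ asc) p≤H)
  s-y-a₀ : (s k · y) ⟨$⟩ʳ a₀ ≡ Fin.suc k
  s-y-a₀ = trans (cong (s k ⟨$⟩ʳ_) (inverseʳ y)) (s-inject₁ k)

stabilises⇒crosses-s· : ∀ {m} (y : Perm m) h → Stabilises (toℕ h) y → Crosses (toℕ h) (s h · y)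
stabilises⇒crosses-s· {m} y h (_ , above) =
  a₀ , ≮⇒≥ (λ h<a₀ → <-irrefl (sym y-a₀) (above a₀ h<a₀)) ,
  subst (toℕ h <_) (sym (cong toℕ s-y-a₀)) (n<1+n (toℕ h))
  where
  a₀ : Fin (suc m)
  a₀ = y ⟨$⟩ˡ inject₁ h
  y-a₀ : toℕ (y ⟨$⟩ʳ a₀) ≡ toℕ h
  y-a₀ = trans (cong toℕ (inverseʳ y)) (toℕ-inject₁ h)
  s-y-a₀ : (s h · y) ⟨$⟩ʳ a₀ ≡ Fin.suc h
  s-y-a₀ = trans (cong (s h ⟨$⟩ʳ_) (inverseʳ y)) (s-inject₁ h)

-- Each letter of a reduced word is a left ascent of the product of the letters after it,
-- and left multiplication by an ascent preserves a crossing of the cut.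
reduced-crosses : ∀ {m} {h : Gen m} r → length r ≡ ℓ (prod r) → h ∈ r → Crosses (toℕ h) (prod r)
reduced-crosses {h = h} (k ∷ r) |kr|≡ℓ h∈kr with ascent⊎descent (flip (prod r)) k
... | inj₂ desc = contradiction 2+|r|≤|r| (λ 2+|r|≤|r| → 1+n≰n (≤-trans (n≤1+n _) 2+|r|≤|r|))
  where
  2+|r|≤|r| : suc (suc (length r)) ≤ length r
  2+|r|≤|r| = ≤-trans (≤-reflexive (trans (cong suc |kr|≡ℓ) (ℓ-s·-descent (prod r) k desc))) (ℓ-prod≤length r)
... | inj₁ asc with Any.any? (h Fin.≟_) r | h∈kr
...   | yes h∈r | _ = crosses-s· (prod r) k asc (reduced-crosses r |r|≡ℓ h∈r)
  where
  |r|≡ℓ : length r ≡ ℓ (prod r)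
  |r|≡ℓ = suc-injective (trans |kr|≡ℓ (ℓ-s·-ascent (prod r) k asc))
...   | no h∉r | here refl = stabilises⇒crosses-s· (prod r) h (stabilises-prod r h∉r)
...   | no h∉r | there h∈r = contradiction h∈r h∉r

supp⇒¬stabilises : ∀ {m} {x : Perm m} {h} → supp x h → ¬ Stabilises (toℕ h) x
supp⇒¬stabilises {x = x} (r , (r≈x , |r|≡ℓx) , h∈r) stab =
  crosses⇒¬stabilises {y = prod r}
    (reduced-crosses r (trans |r|≡ℓx (sym (ℓ-cong {x = prod r} {x} r≈x))) h∈r)
    (stabilises-cong {x = x} {prod r} (λ p → sym (r≈x p)) stab)

¬supp⇒stabilises : ∀ {m} {x : Perm m} {h} → ¬ supp x h → Stabilises (toℕ h) x
¬supp⇒stabilises {x = x} {h} h∉supp with reducedWord x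
... | r , red@(r≈x , _) with Any.any? (h Fin.≟_) r
...   | yes h∈r = contradiction (r , red , h∈r) h∉supp
...   | no h∉r = stabilises-cong {x = prod r} {x} r≈x (stabilises-prod r h∉r)

fixes-below⇒≥ : ∀ {m H} (x : Perm m) → (∀ p → toℕ p < H → x ⟨$⟩ʳ p ≡ p) →
  ∀ {p} → H ≤ toℕ p → H ≤ toℕ (x ⟨$⟩ʳ p)
fixes-below⇒≥ x fixed {p} H≤p = ≮⇒≥ λ xp<H →
  <⇒≱ (subst (_< _) (cong toℕ (⟨$⟩ʳ-injective x (fixed (x ⟨$⟩ʳ p) xp<H))) xp<H) H≤p

fixes-above⇒≤ : ∀ {m H} (x : Perm m) → (∀ p → H < toℕ p → x ⟨$⟩ʳ p ≡ p) →
  ∀ {p} → toℕ p ≤ H → toℕ (x ⟨$⟩ʳ p) ≤ H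
fixes-above⇒≤ x fixed {p} p≤H = ≮⇒≥ λ H<xp →
  <⇒≱ (subst (_ <_) (cong toℕ (⟨$⟩ʳ-injective x (fixed (x ⟨$⟩ʳ p) H<xp))) H<xp) p≤H

fixes-upTo⇒stabilises : ∀ {m H} (x : Perm m) → (∀ p → toℕ p ≤ H → x ⟨$⟩ʳ p ≡ p) →
  Stabilises H x
fixes-upTo⇒stabilises {H = H} x fixed =
  (λ p p≤H → subst (λ q → toℕ q ≤ H) (sym (fixed p p≤H)) p≤H) ,
  (λ p H<p → fixes-below⇒≥ x (λ q → fixed q ∘ ≤-pred) H<p)

fixes-above⇒stabilises : ∀ {m H} (x : Perm m) → (∀ p → H < toℕ p → x ⟨$⟩ʳ p ≡ p) →
  Stabilises H x
fixes-above⇒stabilises {H = H} x fixed =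
  (λ p p≤H → fixes-above⇒≤ x fixed p≤H) ,
  (λ p H<p → subst (λ q → H < toℕ q) (sym (fixed p H<p)) H<p)

stabilises-above⇒fixes : ∀ {m H} (x : Perm m) → (∀ h → H < toℕ h → Stabilises (toℕ h) x) →
  ∀ p → suc H < toℕ p → x ⟨$⟩ʳ p ≡ p
stabilises-above⇒fixes {m} {H} x stab (Fin.suc h) 1+H<1+h = toℕ-injective (≤-antisym upper lower)
  where
  lower : suc (toℕ h) ≤ toℕ (x ⟨$⟩ʳ Fin.suc h)
  lower = proj₂ (stab h (≤-pred 1+H<1+h)) (Fin.suc h) ≤-refl
  upper : toℕ (x ⟨$⟩ʳ Fin.suc h) ≤ suc (toℕ h)
  upper with suc (toℕ h) ℕ.<? m
  ... | yes 1+h<m =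
    subst (toℕ (x ⟨$⟩ʳ Fin.suc h) ≤_) toℕ-h′ (proj₁ (stab h′ H<h′) (Fin.suc h) (≤-reflexive (sym toℕ-h′)))
    where
    h′ : Gen m
    h′ = Fin.fromℕ< 1+h<m
    toℕ-h′ : toℕ h′ ≡ suc (toℕ h)
    toℕ-h′ = toℕ-fromℕ< 1+h<m
    H<h′ : H < toℕ h′
    H<h′ = subst (H <_) (sym toℕ-h′) (<-trans (≤-pred 1+H<1+h) (n<1+n _))
  ... | no 1+h≮m = ≤-trans (≤-pred (toℕ<n _)) (≮⇒≥ 1+h≮m)

InW-RightJ-fixes : ∀ {m} {g : Gen m} {v : Perm m} → InW (RightJ g) v →
  ∀ p → toℕ p < toℕ g → v ⟨$⟩ʳ p ≡ p
InW-RightJ-fixes {g = g} (r , r⊆J , r≈v) p p<g = trans (sym (r≈v p)) (word-fixes r r⊆J)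
  where
  word-fixes : ∀ r → All (RightJ g) r → prod r ⟨$⟩ʳ p ≡ p
  word-fixes [] [] = refl
  word-fixes (k ∷ r) (g≤k ∷ r⊆J) = trans (cong (s k ⟨$⟩ʳ_) (word-fixes r r⊆J))
    (s-fixes k (<⇒≢ (<-≤-trans p<g g≤k)) (<⇒≢ (<-≤-trans p<g (≤-trans g≤k (n≤1+n _)))))

module RightParabolic {m} {w u v : Perm m} {g : Gen m}
  (w≈uv : w ≈ u · v)
  (v∈W : InW (RightJ g) v)
  (u-minimal : ∀ y → InW (RightJ g) y → ℓ u ≤ ℓ (u · y))
  (g∈supp-u : supp u g)
  (supp-u∩J⊆g : ∀ h → supp u h → RightJ g h → h ≡ g)
  (v-leftDescent-g : D_L v g)
  where

  -- i and i+1 are the paper's positions i and i + 1, in 0-based form: toℕ i = G = i − 1.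
  G : ℕ
  G = toℕ g

  i i+1 : Fin (suc m)
  i = inject₁ g
  i+1 = Fin.suc g

  toℕ-i : toℕ i ≡ G
  toℕ-i = toℕ-inject₁ g

  v-fixes-below : ∀ p → toℕ p < G → v ⟨$⟩ʳ p ≡ p
  v-fixes-below = InW-RightJ-fixes {g = g} {v} v∈W

  v-descent : Descent (flip v) g
  v-descent = leftDescent⇒Descent v g v-leftDescent-g

  u-fixes-above : ∀ p → suc G < toℕ p → u ⟨$⟩ʳ p ≡ p
  u-fixes-above = stabilises-above⇒fixes {H = G} u λ h G<h →
    ¬supp⇒stabilises {x = u} {h} λ h∈supp →
      <-irrefl (cong toℕ (sym (supp-u∩J⊆g h h∈supp (<⇒≤ G<h)))) G<h

  u-≤ : ∀ {p} → toℕ p ≤ suc G → toℕ (u ⟨$⟩ʳ p) ≤ suc G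
  u-≤ = fixes-above⇒≤ u u-fixes-above

  u-ascent : Ascent u g
  u-ascent = ¬rightDescent⇒Ascent u g λ ℓus<ℓu →
    <⇒≱ ℓus<ℓu (u-minimal (s g) (g ∷ [] , ≤-refl ∷ [] , λ _ → refl))

  u-i+1≤G : toℕ (u ⟨$⟩ʳ i+1) ≤ G
  u-i+1≤G = ≤-pred (≤∧≢⇒< (u-≤ ≤-refl) λ u-i+1≡i+1 →
    supp⇒¬stabilises {x = u} g∈supp-u (fixes-above⇒stabilises u (fixes-i+1 u-i+1≡i+1)))
    where
    fixes-i+1 : toℕ (u ⟨$⟩ʳ i+1) ≡ suc G → ∀ p → G < toℕ p → u ⟨$⟩ʳ p ≡ p
    fixes-i+1 e p G<p with m≤n⇒m<n∨m≡n G<p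
    ... | inj₁ 1+G<p = u-fixes-above p 1+G<p
    ... | inj₂ 1+G≡p = trans (cong (u ⟨$⟩ʳ_) p≡i+1) (toℕ-injective (trans e (sym (cong toℕ p≡i+1))))
      where
      p≡i+1 : p ≡ i+1
      p≡i+1 = toℕ-injective (sym 1+G≡p)

  u-i<G : toℕ (u ⟨$⟩ʳ i) < G
  u-i<G = <-≤-trans u-ascent u-i+1≤G

  k₀ : Fin (suc m)
  k₀ = u ⟨$⟩ˡ i+1

  k₀<G : toℕ k₀ < G
  k₀<G = ≰⇒> G≰k₀
    where
    u-at : ∀ {p} → k₀ ≡ p → u ⟨$⟩ʳ p ≡ i+1
    u-at k₀≡p = trans (cong (u ⟨$⟩ʳ_) (sym k₀≡p)) (inverseʳ u)
    G≰k₀ : ¬ G ≤ toℕ k₀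
    G≰k₀ G≤k₀ with m≤n⇒m<n∨m≡n G≤k₀
    ... | inj₂ G≡k₀ =
      <⇒≱ u-i<G (subst (G ≤_) (sym (cong toℕ (u-at (toℕ-injective (trans (sym G≡k₀) (sym toℕ-i))))))
                                (n≤1+n G))
    ... | inj₁ G<k₀ with m≤n⇒m<n∨m≡n G<k₀
    ...   | inj₂ 1+G≡k₀ = 1+n≰n (subst (_≤ G) (cong toℕ (u-at (toℕ-injective (sym 1+G≡k₀)))) u-i+1≤G)
    ...   | inj₁ 1+G<k₀ = <-irrefl (cong toℕ (trans (sym (inverseʳ u)) (u-fixes-above k₀ 1+G<k₀))) 1+G<k₀

  w-below : ∀ p → toℕ p < G → w ⟨$⟩ʳ p ≡ u ⟨$⟩ʳ p
  w-below p p<G = trans (w≈uv p) (cong (u ⟨$⟩ʳ_) (v-fixes-below p p<G))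

  w-k₀ : w ⟨$⟩ʳ k₀ ≡ i+1
  w-k₀ = trans (w-below k₀ k₀<G) (inverseʳ u)

  w-via-v : ∀ {p c} → v ⟨$⟩ʳ p ≡ c → w ⟨$⟩ʳ p ≡ u ⟨$⟩ʳ c
  w-via-v {p} vp≡c = trans (w≈uv p) (cong (u ⟨$⟩ʳ_) vp≡c)

  w-via-v-same : ∀ {p q c} → v ⟨$⟩ʳ p ≡ c → v ⟨$⟩ʳ q ≡ c → w ⟨$⟩ʳ p ≡ w ⟨$⟩ʳ q
  w-via-v-same vp≡c vq≡c = trans (w-via-v vp≡c) (sym (w-via-v vq≡c))

  w-prefix-≤ : ∀ p → toℕ p < G → toℕ (w ⟨$⟩ʳ p) ≤ suc G
  w-prefix-≤ p p<G =
    subst (_≤ suc G) (cong toℕ (sym (w-below p p<G))) (u-≤ (≤-trans (<⇒≤ p<G) (n≤1+n G)))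

  v-at-small-value : ∀ {p} → G ≤ toℕ p → toℕ (w ⟨$⟩ʳ p) ≤ suc G →
    v ⟨$⟩ʳ p ≡ i ⊎ v ⟨$⟩ʳ p ≡ i+1
  v-at-small-value {p} G≤p wp≤1+G with m≤n⇒m<n∨m≡n (fixes-below⇒≥ v v-fixes-below G≤p)
  ... | inj₂ G≡vp = inj₁ (toℕ-injective (trans (sym G≡vp) (sym toℕ-i)))
  ... | inj₁ G<vp with m≤n⇒m<n∨m≡n G<vp
  ...   | inj₂ 1+G≡vp = inj₂ (toℕ-injective (sym 1+G≡vp))
  ...   | inj₁ 1+G<vp =
    contradiction (subst (_≤ suc G) (cong toℕ (trans (w-via-v refl) (u-fixes-above _ 1+G<vp))) wp≤1+G)
                  (<⇒≱ 1+G<vp)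

  small-values-inverted : ∀ p q → G ≤ toℕ p → G ≤ toℕ q →
    toℕ (w ⟨$⟩ʳ p) ≤ suc G → toℕ (w ⟨$⟩ʳ q) ≤ suc G →
    toℕ (w ⟨$⟩ʳ q) < toℕ (w ⟨$⟩ʳ p) → toℕ p < toℕ q
  small-values-inverted p q G≤p G≤q wp≤ wq≤ wq<wp
    with v-at-small-value G≤p wp≤ | v-at-small-value G≤q wq≤
  ... | inj₁ vp≡i   | inj₁ vq≡i   = contradiction (cong toℕ (w-via-v-same vq≡i vp≡i)) (<⇒≢ wq<wp)
  ... | inj₂ vp≡i+1 | inj₂ vq≡i+1 = contradiction (cong toℕ (w-via-v-same vq≡i+1 vp≡i+1)) (<⇒≢ wq<wp)
  ... | inj₁ vp≡i   | inj₂ vq≡i+1 = contradiction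
    (subst₂ _<_ (cong toℕ (sym (w-via-v vp≡i))) (cong toℕ (sym (w-via-v vq≡i+1))) u-ascent) (<-asym wq<wp)
  ... | inj₂ vp≡i+1 | inj₁ vq≡i   =
    subst₂ _<_ (cong toℕ (⟨$⟩ʳ⇒⟨$⟩ˡ v vp≡i+1)) (cong toℕ (⟨$⟩ʳ⇒⟨$⟩ˡ v vq≡i)) v-descent

  v-i≢i : v ⟨$⟩ʳ i ≢ i
  v-i≢i v-i≡i =
    <⇒≱ i+1-pos<G (subst (G ≤_) (cong toℕ i+1≡pos) (n≤1+n G))
    where
    i+1-pos<G : toℕ (v ⟨$⟩ˡ i+1) < G
    i+1-pos<G = subst (toℕ (v ⟨$⟩ˡ i+1) <_) (trans (cong toℕ (⟨$⟩ʳ⇒⟨$⟩ˡ v v-i≡i)) toℕ-i) v-descent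
    i+1≡pos : i+1 ≡ v ⟨$⟩ˡ i+1
    i+1≡pos = trans (sym (inverseʳ v)) (v-fixes-below _ i+1-pos<G)

  -- If v(i) = i + 1 then w = (u · s g) · (s g · v), whose first factor fixes the positions
  -- after i + 1 and whose second factor fixes the positions up to i.
  v-i≢i+1 : BruhatIrreducible w → ¬ D_L w g → ¬ D_R w g → v ⟨$⟩ʳ i ≢ i+1
  v-i≢i+1 (_ , no-split) ¬w-leftDescent ¬w-rightDescent v-i≡i+1 =
    no-split (x , y , w≈xy , x≉id , y≉id , disjoint)
    where
    x y : Perm m
    x = u · s g
    y = s g · v
    w≈xy : w ≈ x · y
    w≈xy p = trans (w≈uv p) (cong (u ⟨$⟩ʳ_) (sym (s-involutive g (v ⟨$⟩ʳ p))))
    x-fixes-above : ∀ p → suc G < toℕ p → x ⟨$⟩ʳ p ≡ p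
    x-fixes-above p 1+G<p =
      trans (cong (u ⟨$⟩ʳ_) (s-fixes g (>⇒≢ (<-trans (n<1+n G) 1+G<p)) (>⇒≢ 1+G<p))) (u-fixes-above p 1+G<p)
    y-fixes-upTo : ∀ p → toℕ p ≤ G → y ⟨$⟩ʳ p ≡ p
    y-fixes-upTo p p≤G with m≤n⇒m<n∨m≡n p≤G
    ... | inj₁ p<G =
      trans (cong (s g ⟨$⟩ʳ_) (v-fixes-below p p<G)) (s-fixes g (<⇒≢ p<G) (<⇒≢ (<-trans p<G (n<1+n G))))
    ... | inj₂ p≡G rewrite toℕ-injective {i = p} {i} (trans p≡G (sym toℕ-i)) =
      trans (cong (s g ⟨$⟩ʳ_) v-i≡i+1) (s-suc g)
    disjoint : ∀ h → supp x h → supp y h → ⊥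
    disjoint h h∈x h∈y with toℕ h ℕ.≤? G
    ... | yes h≤G = supp⇒¬stabilises {x = y} h∈y
                      (fixes-upTo⇒stabilises y (λ p p≤h → y-fixes-upTo p (≤-trans p≤h h≤G)))
    ... | no h≰G = supp⇒¬stabilises {x = x} h∈x
                     (fixes-above⇒stabilises x (λ p h<p → x-fixes-above p (≤-<-trans (≰⇒> h≰G) h<p)))
    x≉id : ¬ x ≈ idₚ
    x≉id x≈id = <⇒≱ k₀<G (subst₂ _≤_ (trans (cong toℕ (⟨$⟩ʳ⇒⟨$⟩ˡ w w-i≡i)) toℕ-i) (cong toℕ (⟨$⟩ʳ⇒⟨$⟩ˡ w w-k₀))
                                      (<⇒≤ (¬leftDescent⇒Ascent w g ¬w-leftDescent)))
      where
      w-i≡i : w ⟨$⟩ʳ i ≡ i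
      w-i≡i = trans (w-via-v v-i≡i+1) (trans (cong (u ⟨$⟩ʳ_) (sym (s-inject₁ g))) (x≈id i))
    y≉id : ¬ y ≈ idₚ
    y≉id y≈id = <-asym u-ascent (subst₂ _<_ (cong toℕ (w-via-v v-i≡i+1)) (cong toℕ (w-via-v v-i+1≡i))
                                             (¬rightDescent⇒Ascent w g ¬w-rightDescent))
      where
      v-i+1≡i : v ⟨$⟩ʳ i+1 ≡ i
      v-i+1≡i = trans (sym (s-involutive g _)) (trans (cong (s g ⟨$⟩ʳ_) (y≈id i+1)) (s-suc g))

  w-i-large : BruhatIrreducible w → ¬ D_L w g → ¬ D_R w g → suc G < toℕ (w ⟨$⟩ʳ i)
  w-i-large irreducible ¬w-leftDescent ¬w-rightDescent = ≰⇒> λ w-i≤1+G →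
    [ v-i≢i , v-i≢i+1 irreducible ¬w-leftDescent ¬w-rightDescent ]
      (v-at-small-value (≤-reflexive (sym toℕ-i)) w-i≤1+G)

proposition5p4 : ∀ {m} (w : Perm m) (g : Gen m) →
    RightAlmostReducible w g →
      ((∃[ p ] ((pos p < suc (toℕ g)) × (val w p ≡ suc (suc (toℕ g))))) ×
       (∀ p → pos p < suc (toℕ g) → val w p ≤ suc (suc (toℕ g))))
      ×
      (suc (suc (toℕ g)) < val w (inject₁ g))
      ×
      (∀ p q → suc (toℕ g) ≤ pos p → suc (toℕ g) ≤ pos q →
               val w p ≤ suc (suc (toℕ g)) → val w q ≤ suc (suc (toℕ g)) →
               val w q < val w p → pos p < pos q)
proposition5p4 w g
  (irreducible , (u , v , (w≈uv , v∈W , u-minimal) , bp , supp-u∩J) , ¬w-leftDescent , ¬w-rightDescent) =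
  ( (k₀ , s≤s k₀<G , cong (suc ∘ toℕ) w-k₀)
  , λ p p<i → s≤s (w-prefix-≤ p (≤-pred p<i)) )
  , s≤s (w-i-large irreducible ¬w-leftDescent ¬w-rightDescent)
  , λ p q i≤p i≤q wp≤ wq≤ wq<wp →
      s≤s (small-values-inverted p q (≤-pred i≤p) (≤-pred i≤q) (≤-pred wp≤) (≤-pred wq≤) (≤-pred wq<wp))
  where
  g∈supp-u : supp u g
  g∈supp-u = proj₁ (proj₂ (supp-u∩J g) refl)
  open RightParabolic {w = w} {u} {v} {g} w≈uv v∈W u-minimal g∈supp-u
         (λ h h∈supp h∈J → proj₁ (supp-u∩J h) (h∈supp , h∈J)) (bp g g∈supp-u ≤-refl)
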